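{- Let $k_1,k_2>0$, $s,t\ge0$, and let $$A=\begin{bmatrix}0 & J_{k_1,k_2} & X_1\\ J_{k_1,k_2} & 0 & X_2\\ X_3 & X_4 & Y\end{bmatrix},\qquad B=\begin{bmatrix}J_{k_1,k_2} & 0 & X_1\\ 0 & J_{k_1,k_2} & X_2\\ X_3 & X_4 & Y\end{bmatrix}$$ be Gram mates, where $X_1,X_2$ are $k_1\times t$, $X_3,X_4$ are $s\times k_2$ and $Y$ is $s\times t$ $(0,1)$ matrices. Let $R=(R_1,R_2,R_3)$ and $S=(S_1,S_2,S_3)$ be the row and column sum vectors of $A$, partitioned conformally with the row blocks (sizes $k_1,k_1,s$) and column blocks (sizes $k_2,k_2,t$) of $A$. Suppose that for $i=1,2$, no entry of $R_i$ equals an entry of $R_3$, and no entry of $S_i$ equals an entry of $S_3$. Then $A$ is isomorphic to $B$ if and only if the remaining matrix $Y$ is fixable.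
   Context: $J_{p,q}$ is the $p\times q$ all-ones matrix. $(0,1)$ matrices $A,B$ are Gram mates if $AA^T=BB^T$, $A^TA=B^TB$, $A\ne B$; they are isomorphic if $B=PAQ$ for permutation matrices $P,Q$. For $(0,1)$ matrices $Z_1,Z_2$ of equal size, $\mathcal R_{Z_1,Z_2}$ is the set of triples $(P_1,P_2,Q)$ of permutation matrices with $Z_2=P_1Z_1Q$ and $Z_1=P_2Z_2Q$; for $Z_3,Z_4$ with the same number of rows, $\mathcal L_{Z_3,Z_4}$ is the set of triples $(P,Q_3,Q_4)$ of permutation matrices with $Z_3=PZ_3Q_3$ and $Z_4=PZ_4Q_4$. For $A,B$ of the displayed form, $Y$ is called the remaining matrix, and it is fixable if there exist permutation matrices $P$ ($s\times s$) and $Q$ ($t\times t$) with $Y=PYQ$ such that either (i) $(P_1,P_2,Q)\in\mathcal R_{X_1,X_2}$ and $(P,Q_3,Q_4)\in\mathcal L_{X_3,X_4}$ for some permutation matrices $P_1,P_2,Q_3,Q_4$, or (ii) $(Q_3,Q_4,P^T)\in\mathcal R_{X_3^T,X_4^T}$ and $(Q^T,P_1,P_2)\in\mathcal L_{X_1^T,X_2^T}$ for some permutation matrices $P_1,P_2,Q_3,Q_4$. -}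

module Defs where

open import Data.Nat using (ℕ; zero; suc; _+_; _*_)
open import Data.Fin using (Fin; zero; suc; _≟_; splitAt; _↑ˡ_; _↑ʳ_)
open import Data.Fin.Permutation using (Permutation′; _⟨$⟩ʳ_)
open import Data.Sum using (_⊎_; inj₁; inj₂)
open import Data.Product using (Σ; _×_; _,_; ∃-syntax)
open import Relation.Nullary using (¬_; yes; no)
open import Relation.Binary.PropositionalEquality using (_≡_)

Mat : ℕ → ℕ → Set
Mat m n = Fin m → Fin n → ℕ

Binary : ∀ {m n} → Mat m n → Set
Binary {m} {n} A = (i : Fin m) (j : Fin n) → (A i j ≡ 0) ⊎ (A i j ≡ 1)

infix 4 _≐_
_≐_ : ∀ {m n} → Mat m n → Mat m n → Set
_≐_ {m} {n} A B = (i : Fin m) (j : Fin n) → A i j ≡ B i j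

∑ : (n : ℕ) → (Fin n → ℕ) → ℕ
∑ zero f = 0
∑ (suc n) f = f zero + ∑ n (λ i → f (suc i))

infixl 7 _⊗_
_⊗_ : ∀ {m k n} → Mat m k → Mat k n → Mat m n
_⊗_ {m} {k} {n} A B i j = ∑ k (λ l → A i l * B l j)

_ᵀ : ∀ {m n} → Mat m n → Mat n m
(A ᵀ) i j = A j i

O : (p q : ℕ) → Mat p q
O p q i j = 0

J : (p q : ℕ) → Mat p q
J p q i j = 1

PM : ∀ {n} → Permutation′ n → Mat n n
PM π i j with π ⟨$⟩ʳ i ≟ j
... | yes _ = 1
... | no _ = 0

GramMates : ∀ {m n} → Mat m n → Mat m n → Set
GramMates A B = (A ⊗ (A ᵀ) ≐ B ⊗ (B ᵀ)) × ((A ᵀ) ⊗ A ≐ (B ᵀ) ⊗ B) × ¬ (A ≐ B)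

Isomorphic : ∀ {m n} → Mat m n → Mat m n → Set
Isomorphic {m} {n} A B =
  ∃[ P ] ∃[ Q ] (B ≐ PM {m} P ⊗ A ⊗ PM {n} Q)

InR : ∀ {m n} → Mat m n → Mat m n →
      Permutation′ m → Permutation′ m → Permutation′ n → Set
InR Z₁ Z₂ P₁ P₂ Q =
  (Z₂ ≐ PM P₁ ⊗ Z₁ ⊗ PM Q) × (Z₁ ≐ PM P₂ ⊗ Z₂ ⊗ PM Q)

InL : ∀ {m n₃ n₄} → Mat m n₃ → Mat m n₄ →
      Permutation′ m → Permutation′ n₃ → Permutation′ n₄ → Set
InL Z₃ Z₄ P Q₃ Q₄ =
  (Z₃ ≐ PM P ⊗ Z₃ ⊗ PM Q₃) × (Z₄ ≐ PM P ⊗ Z₄ ⊗ PM Q₄)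

-- fixability of the remaining matrix Y (X1,X2 : k1×t ; X3,X4 : s×k2 ; Y : s×t)
-- P^T is written as the matrix transpose (PM P)ᵀ, i.e. literally the transpose.
InR' : ∀ {m n} → Mat m n → Mat m n →
       Permutation′ m → Permutation′ m → Mat n n → Set
InR' Z₁ Z₂ P₁ P₂ Q =
  (Z₂ ≐ PM P₁ ⊗ Z₁ ⊗ Q) × (Z₁ ≐ PM P₂ ⊗ Z₂ ⊗ Q)

InL' : ∀ {m n₃ n₄} → Mat m n₃ → Mat m n₄ →
       Mat m m → Permutation′ n₃ → Permutation′ n₄ → Set
InL' Z₃ Z₄ P Q₃ Q₄ =
  (Z₃ ≐ P ⊗ Z₃ ⊗ PM Q₃) × (Z₄ ≐ P ⊗ Z₄ ⊗ PM Q₄)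

Fixable : ∀ {k₁ k₂ s t} → (X₁ X₂ : Mat k₁ t) (X₃ X₄ : Mat s k₂) (Y : Mat s t) → Set
Fixable {k₁} {k₂} {s} {t} X₁ X₂ X₃ X₄ Y =
  ∃[ P ] ∃[ Q ] ((Y ≐ PM {s} P ⊗ Y ⊗ PM {t} Q) ×
    ((∃[ P₁ ] ∃[ P₂ ] ∃[ Q₃ ] ∃[ Q₄ ]
        (InR X₁ X₂ P₁ P₂ Q × InL X₃ X₄ P Q₃ Q₄))
     ⊎
     (∃[ P₁ ] ∃[ P₂ ] ∃[ Q₃ ] ∃[ Q₄ ]
        (InR' (X₃ ᵀ) (X₄ ᵀ) Q₃ Q₄ ((PM P) ᵀ) × InL' (X₁ ᵀ) (X₂ ᵀ) ((PM Q) ᵀ) P₁ P₂))))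

Block3 : ∀ {r₁ r₂ r₃ c₁ c₂ c₃} →
  Mat r₁ c₁ → Mat r₁ c₂ → Mat r₁ c₃ →
  Mat r₂ c₁ → Mat r₂ c₂ → Mat r₂ c₃ →
  Mat r₃ c₁ → Mat r₃ c₂ → Mat r₃ c₃ →
  Mat (r₁ + r₂ + r₃) (c₁ + c₂ + c₃)
Block3 {r₁} {r₂} {r₃} {c₁} {c₂} {c₃} A₁₁ A₁₂ A₁₃ A₂₁ A₂₂ A₂₃ A₃₁ A₃₂ A₃₃ i j =
  go (splitAt (r₁ + r₂) i) (splitAt (c₁ + c₂) j)
  where
  rw : Fin (c₁ + c₂) ⊎ Fin c₃ →
       (Fin c₁ → ℕ) → (Fin c₂ → ℕ) → (Fin c₃ → ℕ) → ℕ
  rw (inj₁ b) f g h with splitAt c₁ b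
  ... | inj₁ b' = f b'
  ... | inj₂ b' = g b'
  rw (inj₂ b) f g h = h b
  go : Fin (r₁ + r₂) ⊎ Fin r₃ → Fin (c₁ + c₂) ⊎ Fin c₃ → ℕ
  go (inj₁ a) jj with splitAt r₁ a
  ... | inj₁ a' = rw jj (A₁₁ a') (A₁₂ a') (A₁₃ a')
  ... | inj₂ a' = rw jj (A₂₁ a') (A₂₂ a') (A₂₃ a')
  go (inj₂ a) jj = rw jj (A₃₁ a) (A₃₂ a) (A₃₃ a)

rowSum : ∀ {m n} → Mat m n → Fin m → ℕ
rowSum {m} {n} A i = ∑ n (λ j → A i j)

colSum : ∀ {m n} → Mat m n → Fin n → ℕ
colSum {m} {n} A j = ∑ m (λ i → A i j)

idx₁ : ∀ {a b c} → Fin a → Fin (a + b + c)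
idx₁ {a} {b} {c} i = (i ↑ˡ b) ↑ˡ c

idx₂ : ∀ {a b c} → Fin b → Fin (a + b + c)
idx₂ {a} {b} {c} i = (a ↑ʳ i) ↑ˡ c

idx₃ : ∀ {a b c} → Fin c → Fin (a + b + c)
idx₃ {a} {b} {c} i = (a + b) ↑ʳ i

MatA : ∀ {k₁ k₂ s t} → Mat k₁ t → Mat k₁ t → Mat s k₂ → Mat s k₂ → Mat s t →
       Mat (k₁ + k₁ + s) (k₂ + k₂ + t)
MatA {k₁} {k₂} X₁ X₂ X₃ X₄ Y =
  Block3 (O k₁ k₂) (J k₁ k₂) X₁ (J k₁ k₂) (O k₁ k₂) X₂ X₃ X₄ Y

MatB : ∀ {k₁ k₂ s t} → Mat k₁ t → Mat k₁ t → Mat s k₂ → Mat s k₂ → Mat s t →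
       Mat (k₁ + k₁ + s) (k₂ + k₂ + t)
MatB {k₁} {k₂} X₁ X₂ X₃ X₄ Y =
  Block3 (J k₁ k₂) (O k₁ k₂) X₁ (O k₁ k₂) (J k₁ k₂) X₂ X₃ X₄ Y

{-# OPTIONS --safe #-}
-- Gram mates of (0,1) matrices have equal row and column sums (the diagonals of
-- A Aᵀ and Aᵀ A), and if B = P A Q then every row (column) sum of B is the sum of
-- the row (column) of A that P (Q) moves it to.  So the separation hypotheses force
-- P and Q to map the third row and column blocks onto themselves and the first two
-- onto the first two.  On the first two blocks A has the pattern [O J; J O] and B
-- the pattern [J O; O J]; comparing them entry by entry shows that either P swaps
-- the two upper row blocks and Q keeps the two left column blocks, or the other way
-- round.  Restricting P and Q to the blocks gives precisely the data of case (i),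
-- resp. (ii), of fixability; conversely that data assembles into block
-- permutations carrying A onto B.
module Submission where

open import Defs
open import Data.Bool using (Bool; true; false; not; _xor_; if_then_else_)
open import Data.Bool.Properties using (not-injective; not-involutive; xor-comm; xor-identityʳ; not-distribˡ-xor; not-distribʳ-xor)
open import Data.Empty using (⊥-elim)
open import Data.Nat using (ℕ; zero; suc; _+_; _*_)
open import Data.Nat.Properties using (+-identityʳ; *-zeroʳ; *-identityʳ; +-0-commutativeMonoid)
open import Data.Fin using (Fin; zero; suc; _≟_; splitAt; _↑ˡ_; _↑ʳ_)
open import Data.Fin.Properties using (suc-injective; splitAt-↑ˡ; splitAt-↑ʳ; splitAt⁻¹-↑ˡ; splitAt⁻¹-↑ʳ; ↑ˡ-injective; ↑ʳ-injective)
open import Data.Fin.Permutation using (Permutation; Permutation′; _⟨$⟩ʳ_; _⟨$⟩ˡ_; inverseˡ; inverseʳ; permutation; flip)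
open import Data.Sum using (_⊎_; inj₁; inj₂; [_,_]′)
open import Data.Product using (_,_; proj₁; proj₂; ∃-syntax)
open import Function using (_∘_)
open import Function.Bundles using (_⇔_; mk⇔)
open import Function.Definitions using (Injective)
open import Relation.Nullary using (yes; no; contradiction)
open import Relation.Binary.PropositionalEquality hiding (J)
import Algebra.Properties.CommutativeMonoid.Sum as MonoidSum

-- Sums and permutation matrices

∑-cong : ∀ n {f g : Fin n → ℕ} → (∀ i → f i ≡ g i) → ∑ n f ≡ ∑ n g
∑-cong zero    f≗g = refl
∑-cong (suc n) f≗g = cong₂ _+_ (f≗g zero) (∑-cong n (f≗g ∘ suc))

∑-zero : ∀ n (f : Fin n → ℕ) → (∀ i → f i ≡ 0) → ∑ n f ≡ 0
∑-zero zero    f f≗0 = refl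
∑-zero (suc n) f f≗0 = cong₂ _+_ (f≗0 zero) (∑-zero n (f ∘ suc) (f≗0 ∘ suc))

∑-single : ∀ n (f : Fin n → ℕ) c → (∀ i → i ≢ c → f i ≡ 0) → ∑ n f ≡ f c
∑-single (suc n) f zero    f≗0 =
  trans (cong (f zero +_) (∑-zero n (f ∘ suc) (λ i → f≗0 (suc i) λ ()))) (+-identityʳ _)
∑-single (suc n) f (suc c) f≗0 =
  cong₂ _+_ (f≗0 zero λ ()) (∑-single n (f ∘ suc) c (λ i i≢c → f≗0 (suc i) (i≢c ∘ suc-injective)))

∑-permute : ∀ n (f : Fin n → ℕ) (π : Permutation′ n) → ∑ n (f ∘ (π ⟨$⟩ʳ_)) ≡ ∑ n f
∑-permute n f π = trans (∑≡sum n _) (trans (sym (sum-permute f π)) (sym (∑≡sum n f)))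
  where
  open MonoidSum +-0-commutativeMonoid using (sum; sum-permute)
  ∑≡sum : ∀ n (f : Fin n → ℕ) → ∑ n f ≡ sum f
  ∑≡sum zero    f = refl
  ∑≡sum (suc n) f = cong (f zero +_) (∑≡sum n (f ∘ suc))

module _ {n} (π : Permutation′ n) where

  PM-≡1 : ∀ {i j} → π ⟨$⟩ʳ i ≡ j → PM π i j ≡ 1
  PM-≡1 {i} {j} e with π ⟨$⟩ʳ i ≟ j
  ... | yes _ = refl
  ... | no ne = contradiction e ne

  PM-≡0 : ∀ {i j} → π ⟨$⟩ʳ i ≢ j → PM π i j ≡ 0
  PM-≡0 {i} {j} ne with π ⟨$⟩ʳ i ≟ j
  ... | yes e = contradiction e ne
  ... | no _  = refl

  PM-⊗ : ∀ {p} (Z : Mat n p) i j → (PM π ⊗ Z) i j ≡ Z (π ⟨$⟩ʳ i) j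
  PM-⊗ Z i j = begin
    ∑ n (λ l → PM π i l * Z l j)           ≡⟨ ∑-single n _ (π ⟨$⟩ʳ i) off-target ⟩
    PM π i (π ⟨$⟩ʳ i) * Z (π ⟨$⟩ʳ i) j      ≡⟨ cong (_* Z (π ⟨$⟩ʳ i) j) (PM-≡1 refl) ⟩
    Z (π ⟨$⟩ʳ i) j + 0                     ≡⟨ +-identityʳ _ ⟩
    Z (π ⟨$⟩ʳ i) j                         ∎
    where
    open ≡-Reasoning
    off-target : ∀ l → l ≢ π ⟨$⟩ʳ i → PM π i l * Z l j ≡ 0
    off-target l l≢πi = cong (_* Z l j) (PM-≡0 (l≢πi ∘ sym))

  ⊗-PM : ∀ {p} (Z : Mat p n) i j → (Z ⊗ PM π) i j ≡ Z i (π ⟨$⟩ˡ j)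
  ⊗-PM Z i j = begin
    ∑ n (λ l → Z i l * PM π l j)            ≡⟨ ∑-single n _ (π ⟨$⟩ˡ j) off-source ⟩
    Z i (π ⟨$⟩ˡ j) * PM π (π ⟨$⟩ˡ j) j       ≡⟨ cong (Z i (π ⟨$⟩ˡ j) *_) (PM-≡1 (inverseʳ π)) ⟩
    Z i (π ⟨$⟩ˡ j) * 1                      ≡⟨ *-identityʳ _ ⟩
    Z i (π ⟨$⟩ˡ j)                          ∎
    where
    open ≡-Reasoning
    off-source : ∀ l → l ≢ π ⟨$⟩ˡ j → Z i l * PM π l j ≡ 0
    off-source l l≢π⁻¹j =
      trans (cong (Z i l *_) (PM-≡0 (λ e → l≢π⁻¹j (trans (sym (inverseˡ π)) (cong (π ⟨$⟩ˡ_) e))))) (*-zeroʳ (Z i l))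

  PMᵀ≐PM-flip : (PM π) ᵀ ≐ PM (flip π)
  PMᵀ≐PM-flip i j with π ⟨$⟩ˡ i ≟ j
  ... | yes e = PM-≡1 (trans (cong (π ⟨$⟩ʳ_) (sym e)) (inverseʳ π))
  ... | no ne = PM-≡0 (λ e → ne (trans (cong (π ⟨$⟩ˡ_) (sym e)) (inverseˡ π)))

⊗-congˡ : ∀ {m k n} {A A′ : Mat m k} (B : Mat k n) → A ≐ A′ → A ⊗ B ≐ A′ ⊗ B
⊗-congˡ {k = k} B A≐A′ i j = ∑-cong k (λ l → cong (_* B l j) (A≐A′ i l))

⊗-congʳ : ∀ {m k n} (A : Mat m k) {B B′ : Mat k n} → B ≐ B′ → A ⊗ B ≐ A ⊗ B′
⊗-congʳ {k = k} A B≐B′ i j = ∑-cong k (λ l → cong (A i l *_) (B≐B′ l j))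

permute : ∀ {m n} (P : Permutation′ m) (Q : Permutation′ n) (W : Mat m n) i j →
          (PM P ⊗ W ⊗ PM Q) i j ≡ W (P ⟨$⟩ʳ i) (Q ⟨$⟩ˡ j)
permute P Q W i j = trans (⊗-PM Q (PM P ⊗ W) i j) (PM-⊗ P W i _)

permute-ᵀʳ : ∀ {m n} (P : Permutation′ m) (Q : Permutation′ n) (W : Mat m n) i j →
             (PM P ⊗ W ⊗ (PM Q) ᵀ) i j ≡ W (P ⟨$⟩ʳ i) (Q ⟨$⟩ʳ j)
permute-ᵀʳ P Q W i j = trans (⊗-congʳ (PM P ⊗ W) (PMᵀ≐PM-flip Q) i j) (permute P (flip Q) W i j)

permute-ᵀˡ : ∀ {m n} (P : Permutation′ m) (Q : Permutation′ n) (W : Mat m n) i j →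
             ((PM P) ᵀ ⊗ W ⊗ PM Q) i j ≡ W (P ⟨$⟩ˡ i) (Q ⟨$⟩ˡ j)
permute-ᵀˡ P Q W i j = trans (⊗-congˡ (PM Q) (⊗-congˡ W (PMᵀ≐PM-flip P)) i j) (permute (flip P) Q W i j)

binary-square : ∀ {a} → a ≡ 0 ⊎ a ≡ 1 → a * a ≡ a
binary-square (inj₁ refl) = refl
binary-square (inj₂ refl) = refl

module _ {m n} {M N : Mat m n} (M-binary : Binary M) (N-binary : Binary N) (gram : GramMates M N) where

  GramMates⇒rowSum-≡ : ∀ i → rowSum M i ≡ rowSum N i
  GramMates⇒rowSum-≡ i = begin
    rowSum M i        ≡⟨ ∑-cong n (λ j → sym (binary-square (M-binary i j))) ⟩
    (M ⊗ M ᵀ) i i     ≡⟨ proj₁ gram i i ⟩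
    (N ⊗ N ᵀ) i i     ≡⟨ ∑-cong n (λ j → binary-square (N-binary i j)) ⟩
    rowSum N i        ∎
    where open ≡-Reasoning

  GramMates⇒colSum-≡ : ∀ j → colSum M j ≡ colSum N j
  GramMates⇒colSum-≡ j = begin
    colSum M j        ≡⟨ ∑-cong m (λ i → sym (binary-square (M-binary i j))) ⟩
    (M ᵀ ⊗ M) j j     ≡⟨ proj₁ (proj₂ gram) j j ⟩
    (N ᵀ ⊗ N) j j     ≡⟨ ∑-cong m (λ i → binary-square (N-binary i j)) ⟩
    colSum N j        ∎
    where open ≡-Reasoning

-- Partitions into three blocks

-- The blocks of Fin (n + n + k): core false and core true are the two blocks of
-- size n, rim is the last one.
data Part : Set where
  core : Bool → Part
  rim  : Part

xor-cancelˡ : ∀ c u → c xor (c xor u) ≡ u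
xor-cancelˡ false u = refl
xor-cancelˡ true  u = not-involutive u

shift : Bool → Part → Part
shift c (core u) = core (c xor u)
shift c rim      = rim

shift-involutive : ∀ c p → shift c (shift c p) ≡ p
shift-involutive c (core u) = cong core (xor-cancelˡ c u)
shift-involutive c rim      = refl

shift-injective : ∀ c → Injective _≡_ _≡_ (shift c)
shift-injective c {p} {q} e =
  trans (sym (shift-involutive c p)) (trans (cong (shift c) e) (shift-involutive c q))

module Partition (n k : ℕ) where

  size : Part → ℕ
  size (core _) = n
  size rim      = k

  ι : (p : Part) → Fin (size p) → Fin (n + n + k)
  ι (core false) = idx₁ {n} {n} {k}
  ι (core true)  = idx₂ {n} {n} {k}
  ι rim          = idx₃ {n} {n} {k}

  -- Unlike a function defined by matching on locate, elim computes on ι p x (elim-ι).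
  elim : {X : Set} → ((p : Part) → Fin (size p) → X) → Fin (n + n + k) → X
  elim f i = [ (λ u → [ f (core false) , f (core true) ]′ (splitAt n u)) , f rim ]′ (splitAt (n + n) i)

  elim-ι : ∀ {X : Set} (f : (p : Part) → Fin (size p) → X) p x → elim f (ι p x) ≡ f p x
  elim-ι f (core false) x rewrite splitAt-↑ˡ (n + n) (x ↑ˡ n) k | splitAt-↑ˡ n x n = refl
  elim-ι f (core true)  x rewrite splitAt-↑ˡ (n + n) (n ↑ʳ x) k | splitAt-↑ʳ n n x = refl
  elim-ι f rim          x rewrite splitAt-↑ʳ (n + n) k x = refl

  ι-disjoint : ∀ {p q x y} → ι p x ≡ ι q y → p ≡ q
  ι-disjoint {p} {q} {x} {y} e =
    trans (sym (elim-ι part p x)) (trans (cong (elim part) e) (elim-ι part q y))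
    where
    part : (p : Part) → Fin (size p) → Part
    part p _ = p

  ι-injective : ∀ p {x y} → ι p x ≡ ι p y → x ≡ y
  ι-injective (core false) e = ↑ˡ-injective n _ _ (↑ˡ-injective k _ _ e)
  ι-injective (core true)  e = ↑ʳ-injective n _ _ (↑ˡ-injective k _ _ e)
  ι-injective rim          e = ↑ʳ-injective (n + n) _ _ e

  data Located : Fin (n + n + k) → Set where
    at : (p : Part) (x : Fin (size p)) → Located (ι p x)

  locate : ∀ i → Located i
  locate i with splitAt (n + n) i in eq
  ... | inj₂ z = subst Located (splitAt⁻¹-↑ʳ eq) (at rim z)
  ... | inj₁ u with splitAt n u in eq′
  ...   | inj₁ x = subst Located (trans (cong (_↑ˡ k) (splitAt⁻¹-↑ˡ eq′)) (splitAt⁻¹-↑ˡ eq)) (at (core false) x)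
  ...   | inj₂ x = subst Located (trans (cong (_↑ˡ k) (splitAt⁻¹-↑ʳ eq′)) (splitAt⁻¹-↑ˡ eq)) (at (core true) x)

  Sends : (Fin (n + n + k) → Fin (n + n + k)) → Part → Part → Set
  Sends f p q = ∀ x → ∃[ y ] f (ι p x) ≡ ι q y

  module Separation (f : Fin (n + n + k) → Fin (n + n + k)) (w : Fin (n + n + k) → ℕ)
                    (w-invariant : ∀ i → w (f i) ≡ w i)
                    (separated : ∀ u x r → w (ι (core u) x) ≢ w (ι rim r)) where

    rim↦rim : Sends f rim rim
    rim↦rim r = classify (locate (f (ι rim r))) refl
      where
      classify : ∀ {i} → Located i → f (ι rim r) ≡ i → ∃[ y ] f (ι rim r) ≡ ι rim y
      classify (at (core u) x) e = ⊥-elim (separated u x r (trans (cong w (sym e)) (w-invariant _)))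
      classify (at rim y)      e = y , e

    core↦core : ∀ u x → ∃[ v ] ∃[ y ] f (ι (core u) x) ≡ ι (core v) y
    core↦core u x = classify (locate (f (ι (core u) x))) refl
      where
      classify : ∀ {i} → Located i → f (ι (core u) x) ≡ i → ∃[ v ] ∃[ y ] f (ι (core u) x) ≡ ι (core v) y
      classify (at (core v) y) e = v , y , e
      classify (at rim r)      e = ⊥-elim (separated u x r (trans (sym (w-invariant _)) (cong w e)))

  Family : (Part → Part) → Set
  Family π = (p : Part) → Permutation (size p) (size (π p))

  module Restriction (σ : Permutation′ (n + n + k)) {π : Part → Part} (π-injective : Injective _≡_ _≡_ π)
                     (sends : ∀ p → Sends (σ ⟨$⟩ʳ_) p (π p)) where

    sends⁻¹ : ∀ p → Sends (σ ⟨$⟩ˡ_) (π p) p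
    sends⁻¹ p y = preimage (locate (σ ⟨$⟩ˡ ι (π p) y)) (inverseʳ σ)
      where
      preimage : ∀ {i} → Located i → σ ⟨$⟩ʳ i ≡ ι (π p) y → ∃[ x ] i ≡ ι p x
      preimage (at q x) e with π-injective (ι-disjoint (trans (sym (proj₂ (sends q x))) e))
      ... | refl = x , refl

    restrict : Family π
    restrict p = permutation (proj₁ ∘ sends p) (proj₁ ∘ sends⁻¹ p) to∘from from∘to
      where
      to∘from : ∀ y → proj₁ (sends p (proj₁ (sends⁻¹ p y))) ≡ y
      to∘from y = ι-injective (π p) (begin
        ι (π p) _                         ≡⟨ sym (proj₂ (sends p _)) ⟩
        σ ⟨$⟩ʳ ι p _                      ≡⟨ cong (σ ⟨$⟩ʳ_) (sym (proj₂ (sends⁻¹ p y))) ⟩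
        σ ⟨$⟩ʳ (σ ⟨$⟩ˡ ι (π p) y)          ≡⟨ inverseʳ σ ⟩
        ι (π p) y                         ∎)
        where open ≡-Reasoning
      from∘to : ∀ x → proj₁ (sends⁻¹ p (proj₁ (sends p x))) ≡ x
      from∘to x = ι-injective p (begin
        ι p _                             ≡⟨ sym (proj₂ (sends⁻¹ p _)) ⟩
        σ ⟨$⟩ˡ ι (π p) _                  ≡⟨ cong (σ ⟨$⟩ˡ_) (sym (proj₂ (sends p x))) ⟩
        σ ⟨$⟩ˡ (σ ⟨$⟩ʳ ι p x)              ≡⟨ inverseˡ σ ⟩
        ι p x                             ∎)
        where open ≡-Reasoning

    restrict-ι : ∀ p x → σ ⟨$⟩ʳ ι p x ≡ ι (π p) (restrict p ⟨$⟩ʳ x)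
    restrict-ι p x = proj₂ (sends p x)

  module Assembly (c : Bool) (φ : Family (shift c)) where

    forth back : (p : Part) → Fin (size p) → Fin (n + n + k)
    forth p x = ι (shift c p) (φ p ⟨$⟩ʳ x)
    back (core u) y = ι (core (c xor u)) (φ (core (c xor u)) ⟨$⟩ˡ y)
    back rim      y = ι rim (φ rim ⟨$⟩ˡ y)

    forth∘back : ∀ i → elim forth (elim back i) ≡ i
    forth∘back i with locate i
    ... | at (core u) y = begin
      elim forth (elim back (ι (core u) y))                ≡⟨ cong (elim forth) (elim-ι back (core u) y) ⟩
      elim forth (ι (core (c xor u)) _)                    ≡⟨ elim-ι forth (core (c xor u)) _ ⟩
      ι (core (c xor (c xor u))) (φ _ ⟨$⟩ʳ (φ _ ⟨$⟩ˡ y))    ≡⟨ cong (ι (core (c xor (c xor u)))) (inverseʳ (φ (core (c xor u)))) ⟩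
      ι (core (c xor (c xor u))) y                         ≡⟨ cong (λ v → ι (core v) y) (xor-cancelˡ c u) ⟩
      ι (core u) y                                         ∎
      where open ≡-Reasoning
    ... | at rim y =
      trans (cong (elim forth) (elim-ι back rim y)) (trans (elim-ι forth rim _) (cong (ι rim) (inverseʳ (φ rim))))

    back∘forth : ∀ i → elim back (elim forth i) ≡ i
    back∘forth i with locate i
    ... | at (core u) x =
      trans (cong (elim back) (elim-ι forth (core u) x)) (trans (elim-ι back (core (c xor u)) _) (cancel (xor-cancelˡ c u)))
      where
      cancel : ∀ {v} → v ≡ u → ι (core v) (φ (core v) ⟨$⟩ˡ (φ (core u) ⟨$⟩ʳ x)) ≡ ι (core u) x
      cancel refl = cong (ι (core u)) (inverseˡ (φ (core u)))
    ... | at rim x =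
      trans (cong (elim back) (elim-ι forth rim x)) (trans (elim-ι back rim _) (cong (ι rim) (inverseˡ (φ rim))))

    assemble : Permutation′ (n + n + k)
    assemble = permutation (elim forth) (elim back) forth∘back back∘forth

    assemble-ι : ∀ p x → assemble ⟨$⟩ʳ ι p x ≡ ι (shift c p) (φ p ⟨$⟩ʳ x)
    assemble-ι = elim-ι forth

-- Block matrices

module BlockEntries {n k m l : ℕ}
  (A₁₁ A₁₂ : Mat n m) (A₁₃ : Mat n l) (A₂₁ A₂₂ : Mat n m) (A₂₃ : Mat n l)
  (A₃₁ A₃₂ : Mat k m) (A₃₃ : Mat k l) where

  private
    module R = Partition n k
    module C = Partition m l

  block : (p q : Part) → Mat (R.size p) (C.size q)
  block (core u) (core v) = if u then (if v then A₂₂ else A₂₁) else (if v then A₁₂ else A₁₁)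
  block (core u) rim      = if u then A₂₃ else A₁₃
  block rim      (core v) = if v then A₃₂ else A₃₁
  block rim      rim      = A₃₃

  Block3-ι : ∀ p q x y → Block3 A₁₁ A₁₂ A₁₃ A₂₁ A₂₂ A₂₃ A₃₁ A₃₂ A₃₃ (R.ι p x) (C.ι q y) ≡ block p q x y
  Block3-ι (core false) (core false) x y
    rewrite splitAt-↑ˡ (n + n) (x ↑ˡ n) k | splitAt-↑ˡ n x n | splitAt-↑ˡ (m + m) (y ↑ˡ m) l | splitAt-↑ˡ m y m = refl
  Block3-ι (core false) (core true) x y
    rewrite splitAt-↑ˡ (n + n) (x ↑ˡ n) k | splitAt-↑ˡ n x n | splitAt-↑ˡ (m + m) (m ↑ʳ y) l | splitAt-↑ʳ m m y = refl
  Block3-ι (core false) rim x y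
    rewrite splitAt-↑ˡ (n + n) (x ↑ˡ n) k | splitAt-↑ˡ n x n | splitAt-↑ʳ (m + m) l y = refl
  Block3-ι (core true) (core false) x y
    rewrite splitAt-↑ˡ (n + n) (n ↑ʳ x) k | splitAt-↑ʳ n n x | splitAt-↑ˡ (m + m) (y ↑ˡ m) l | splitAt-↑ˡ m y m = refl
  Block3-ι (core true) (core true) x y
    rewrite splitAt-↑ˡ (n + n) (n ↑ʳ x) k | splitAt-↑ʳ n n x | splitAt-↑ˡ (m + m) (m ↑ʳ y) l | splitAt-↑ʳ m m y = refl
  Block3-ι (core true) rim x y
    rewrite splitAt-↑ˡ (n + n) (n ↑ʳ x) k | splitAt-↑ʳ n n x | splitAt-↑ʳ (m + m) l y = refl
  Block3-ι rim (core false) x y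
    rewrite splitAt-↑ʳ (n + n) k x | splitAt-↑ˡ (m + m) (y ↑ˡ m) l | splitAt-↑ˡ m y m = refl
  Block3-ι rim (core true) x y
    rewrite splitAt-↑ʳ (n + n) k x | splitAt-↑ˡ (m + m) (m ↑ʳ y) l | splitAt-↑ʳ m m y = refl
  Block3-ι rim rim x y
    rewrite splitAt-↑ʳ (n + n) k x | splitAt-↑ʳ (m + m) l y = refl

  Block3-binary : (∀ p q → Binary (block p q)) → Binary (Block3 A₁₁ A₁₂ A₁₃ A₂₁ A₂₂ A₂₃ A₃₁ A₃₂ A₃₃)
  Block3-binary blocks-binary i j with R.locate i | C.locate j
  ... | R.at p x | C.at q y rewrite Block3-ι p q x y = blocks-binary p q x y

module BlockwiseIsomorphism {n k m l : ℕ} (M N : Mat (n + n + k) (m + m + l)) where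

  private
    module R = Partition n k
    module C = Partition m l

  BlockwiseIso : (c c′ : Bool) → R.Family (shift c) → C.Family (shift c′) → Set
  BlockwiseIso c c′ φ ψ = ∀ p q x y →
    N (R.ι p x) (C.ι q y) ≡ M (R.ι (shift c p) (φ p ⟨$⟩ʳ x)) (C.ι (shift c′ q) (ψ q ⟨$⟩ʳ y))

  blockwiseIso⇒isomorphic : ∀ {c c′ φ ψ} → BlockwiseIso c c′ φ ψ → Isomorphic M N
  blockwiseIso⇒isomorphic {c} {c′} {φ} {ψ} iso =
    σ , τ , λ i j → trans (entry (R.locate i) (C.locate j)) (sym (permute σ τ M i j))
    where
    σ = R.Assembly.assemble c φ
    τ = flip (C.Assembly.assemble c′ ψ)
    entry : ∀ {i j} → R.Located i → C.Located j → N i j ≡ M (σ ⟨$⟩ʳ i) (τ ⟨$⟩ˡ j)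
    entry (R.at p x) (C.at q y) =
      trans (iso p q x y) (sym (cong₂ M (R.Assembly.assemble-ι c φ p x) (C.Assembly.assemble-ι c′ ψ q y)))

  isomorphic⇒blockwiseIso : ∀ {c c′} (σ : Permutation′ (n + n + k)) (τ : Permutation′ (m + m + l)) →
    N ≐ PM σ ⊗ M ⊗ PM τ →
    (∀ p → R.Sends (σ ⟨$⟩ʳ_) p (shift c p)) → (∀ q → C.Sends (τ ⟨$⟩ˡ_) q (shift c′ q)) →
    ∃[ φ ] ∃[ ψ ] BlockwiseIso c c′ φ ψ
  isomorphic⇒blockwiseIso {c} {c′} σ τ N≐σMτ σ-sends τ⁻¹-sends =
    Rσ.restrict , Cτ.restrict ,
    λ p q x y → trans (trans (N≐σMτ _ _) (permute σ τ M _ _)) (cong₂ M (Rσ.restrict-ι p x) (Cτ.restrict-ι q y))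
    where
    module Rσ = R.Restriction σ (shift-injective c) σ-sends
    module Cτ = C.Restriction (flip τ) (shift-injective c′) τ⁻¹-sends

-- The matrices A and B

indicator : Bool → ℕ
indicator false = 0
indicator true  = 1

indicator-injective : ∀ {a b} → indicator a ≡ indicator b → a ≡ b
indicator-injective {false} {false} _ = refl
indicator-injective {true}  {true}  _ = refl

xor≡not⇒ : ∀ a {b c} → a xor b ≡ not c → b ≡ not a xor c
xor≡not⇒ false e = e
xor≡not⇒ true  e = not-injective e

module MatAB {n k m l : ℕ} (X₁ X₂ : Mat n l) (X₃ X₄ : Mat k m) (Y : Mat k l) where

  private
    module R = Partition n k
    module C = Partition m l
    module BA = BlockEntries (O n m) (J n m) X₁ (J n m) (O n m) X₂ X₃ X₄ Y
    module BB = BlockEntries (J n m) (O n m) X₁ (O n m) (J n m) X₂ X₃ X₄ Y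
    A = MatA X₁ X₂ X₃ X₄ Y
    B = MatB X₁ X₂ X₃ X₄ Y

  open BlockwiseIsomorphism {n} {k} {m} {l} A B using (BlockwiseIso; blockwiseIso⇒isomorphic; isomorphic⇒blockwiseIso)

  A-core : ∀ u v x y → BA.block (core u) (core v) x y ≡ indicator (u xor v)
  A-core false false x y = refl
  A-core false true  x y = refl
  A-core true  false x y = refl
  A-core true  true  x y = refl

  B-core : ∀ u v x y → BB.block (core u) (core v) x y ≡ indicator (not (u xor v))
  B-core false false x y = refl
  B-core false true  x y = refl
  B-core true  false x y = refl
  B-core true  true  x y = refl

  core-match : ∀ c u v x y x′ y′ → BB.block (core u) (core v) x y ≡ BA.block (core (c xor u)) (core (not c xor v)) x′ y′
  core-match c u v x y x′ y′ =
    trans (B-core u v x y) (trans (cong indicator (shifted c)) (sym (A-core (c xor u) (not c xor v) x′ y′)))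
    where
    shifted : ∀ c → not (u xor v) ≡ (c xor u) xor (not c xor v)
    shifted false = not-distribʳ-xor u v
    shifted true  = not-distribˡ-xor u v

  BlocksMatch : (c : Bool) → R.Family (shift c) → C.Family (shift (not c)) → Set
  BlocksMatch c φ ψ = ∀ p q x y →
    BB.block p q x y ≡ BA.block (shift c p) (shift (not c) q) (φ p ⟨$⟩ʳ x) (ψ q ⟨$⟩ʳ y)

  blocksMatch⇒blockwiseIso : ∀ {c φ ψ} → BlocksMatch c φ ψ → BlockwiseIso c (not c) φ ψ
  blocksMatch⇒blockwiseIso {c} {φ} {ψ} match p q x y =
    trans (BB.Block3-ι p q x y)
          (trans (match p q x y) (sym (BA.Block3-ι (shift c p) (shift (not c) q) (φ p ⟨$⟩ʳ x) (ψ q ⟨$⟩ʳ y))))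

  blockwiseIso⇒blocksMatch : ∀ {c φ ψ} → BlockwiseIso c (not c) φ ψ → BlocksMatch c φ ψ
  blockwiseIso⇒blocksMatch {c} {φ} {ψ} iso p q x y =
    trans (sym (BB.Block3-ι p q x y))
          (trans (iso p q x y) (BA.Block3-ι (shift c p) (shift (not c) q) (φ p ⟨$⟩ʳ x) (ψ q ⟨$⟩ʳ y)))

  fixable⇒blocksMatch : Fixable X₁ X₂ X₃ X₄ Y → ∃[ c ] ∃[ φ ] ∃[ ψ ] BlocksMatch c φ ψ
  fixable⇒blocksMatch
    (P , Q , Y≐PYQ , inj₁ (P₁ , P₂ , Q₃ , Q₄ , (X₂≐P₁X₁Q , X₁≐P₂X₂Q) , (X₃≐PX₃Q₃ , X₄≐PX₄Q₄))) =
    true , φ , ψ , match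
    where
    φ : R.Family (shift true)
    φ (core false) = P₂
    φ (core true)  = P₁
    φ rim          = P
    ψ : C.Family (shift false)
    ψ (core false) = flip Q₃
    ψ (core true)  = flip Q₄
    ψ rim          = flip Q
    match : BlocksMatch true φ ψ
    match (core u)     (core v)     x y = core-match true u v x y _ _
    match (core false) rim          x r = trans (X₁≐P₂X₂Q x r) (permute P₂ Q X₂ x r)
    match (core true)  rim          x r = trans (X₂≐P₁X₁Q x r) (permute P₁ Q X₁ x r)
    match rim          (core false) r y = trans (X₃≐PX₃Q₃ r y) (permute P Q₃ X₃ r y)
    match rim          (core true)  r y = trans (X₄≐PX₄Q₄ r y) (permute P Q₄ X₄ r y)
    match rim          rim          r c = trans (Y≐PYQ r c) (permute P Q Y r c)
  fixable⇒blocksMatch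
    (P , Q , Y≐PYQ , inj₂ (P₁ , P₂ , Q₃ , Q₄ , (X₄ᵀ≐Q₃X₃ᵀPᵀ , X₃ᵀ≐Q₄X₄ᵀPᵀ) , (X₁ᵀ≐QᵀX₁ᵀP₁ , X₂ᵀ≐QᵀX₂ᵀP₂))) =
    false , φ , ψ , match
    where
    φ : R.Family (shift false)
    φ (core false) = flip P₁
    φ (core true)  = flip P₂
    φ rim          = P
    ψ : C.Family (shift true)
    ψ (core false) = Q₄
    ψ (core true)  = Q₃
    ψ rim          = flip Q
    match : BlocksMatch false φ ψ
    match (core u)     (core v)     x y = core-match false u v x y _ _
    match (core false) rim          x r = trans (X₁ᵀ≐QᵀX₁ᵀP₁ r x) (permute-ᵀˡ Q P₁ (X₁ ᵀ) r x)
    match (core true)  rim          x r = trans (X₂ᵀ≐QᵀX₂ᵀP₂ r x) (permute-ᵀˡ Q P₂ (X₂ ᵀ) r x)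
    match rim          (core false) r y = trans (X₃ᵀ≐Q₄X₄ᵀPᵀ y r) (permute-ᵀʳ Q₄ P (X₄ ᵀ) y r)
    match rim          (core true)  r y = trans (X₄ᵀ≐Q₃X₃ᵀPᵀ y r) (permute-ᵀʳ Q₃ P (X₃ ᵀ) y r)
    match rim          rim          r c = trans (Y≐PYQ r c) (permute P Q Y r c)

  blocksMatch⇒fixable : ∀ {c φ ψ} → BlocksMatch c φ ψ → Fixable X₁ X₂ X₃ X₄ Y
  blocksMatch⇒fixable {true} {φ} {ψ} match =
    P , Q , (λ r c → trans (match rim rim r c) (sym (permute P Q Y r c))) ,
    inj₁ (P₁ , P₂ , Q₃ , Q₄ ,
          ((λ x r → trans (match (core true) rim x r) (sym (permute P₁ Q X₁ x r))) ,
           (λ x r → trans (match (core false) rim x r) (sym (permute P₂ Q X₂ x r)))) ,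
          ((λ r y → trans (match rim (core false) r y) (sym (permute P Q₃ X₃ r y))) ,
           (λ r y → trans (match rim (core true) r y) (sym (permute P Q₄ X₄ r y)))))
    where
    P = φ rim
    Q = flip (ψ rim)
    P₁ = φ (core true)
    P₂ = φ (core false)
    Q₃ = flip (ψ (core false))
    Q₄ = flip (ψ (core true))
  blocksMatch⇒fixable {false} {φ} {ψ} match =
    P , Q , (λ r c → trans (match rim rim r c) (sym (permute P Q Y r c))) ,
    inj₂ (P₁ , P₂ , Q₃ , Q₄ ,
          ((λ y r → trans (match rim (core true) r y) (sym (permute-ᵀʳ Q₃ P (X₃ ᵀ) y r))) ,
           (λ y r → trans (match rim (core false) r y) (sym (permute-ᵀʳ Q₄ P (X₄ ᵀ) y r)))) ,
          ((λ r x → trans (match (core false) rim x r) (sym (permute-ᵀˡ Q P₁ (X₁ ᵀ) r x))) ,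
           (λ r x → trans (match (core true) rim x r) (sym (permute-ᵀˡ Q P₂ (X₂ ᵀ) r x)))))
    where
    P = φ rim
    Q = flip (ψ rim)
    P₁ = flip (φ (core false))
    P₂ = flip (φ (core true))
    Q₃ = ψ (core true)
    Q₄ = ψ (core false)

  private
    Bit : ℕ → Set
    Bit a = a ≡ 0 ⊎ a ≡ 1

    indicator-bit : ∀ b → Bit (indicator b)
    indicator-bit false = inj₁ refl
    indicator-bit true  = inj₂ refl

  module _ (X₁-binary : Binary X₁) (X₂-binary : Binary X₂) (X₃-binary : Binary X₃) (X₄-binary : Binary X₄)
           (Y-binary : Binary Y) where

    A-binary : Binary A
    A-binary = BA.Block3-binary blocks-binary
      where
      blocks-binary : ∀ p q → Binary (BA.block p q)
      blocks-binary (core u)     (core v)     x y = subst Bit (sym (A-core u v x y)) (indicator-bit (u xor v))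
      blocks-binary (core false) rim          = X₁-binary
      blocks-binary (core true)  rim          = X₂-binary
      blocks-binary rim          (core false) = X₃-binary
      blocks-binary rim          (core true)  = X₄-binary
      blocks-binary rim          rim          = Y-binary

    B-binary : Binary B
    B-binary = BB.Block3-binary blocks-binary
      where
      blocks-binary : ∀ p q → Binary (BB.block p q)
      blocks-binary (core u)     (core v)     x y = subst Bit (sym (B-core u v x y)) (indicator-bit (not (u xor v)))
      blocks-binary (core false) rim          = X₁-binary
      blocks-binary (core true)  rim          = X₂-binary
      blocks-binary rim          (core false) = X₃-binary
      blocks-binary rim          (core true)  = X₄-binary
      blocks-binary rim          rim          = Y-binary

  module FromIsomorphism (x₀ : Fin n) (y₀ : Fin m)
      (row-separated : ∀ u x r → rowSum A (R.ι (core u) x) ≢ rowSum A (R.ι rim r))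
      (col-separated : ∀ v y c → colSum A (C.ι (core v) y) ≢ colSum A (C.ι rim c))
      (rowSum-≡ : ∀ i → rowSum A i ≡ rowSum B i) (colSum-≡ : ∀ j → colSum A j ≡ colSum B j)
      (σ : Permutation′ (n + n + k)) (τ : Permutation′ (m + m + l)) (B≐σAτ : B ≐ PM σ ⊗ A ⊗ PM τ) where

    entry : ∀ i j → B i j ≡ A (σ ⟨$⟩ʳ i) (τ ⟨$⟩ˡ j)
    entry i j = trans (B≐σAτ i j) (permute σ τ A i j)

    rowSum-invariant : ∀ i → rowSum A (σ ⟨$⟩ʳ i) ≡ rowSum A i
    rowSum-invariant i = begin
      rowSum A (σ ⟨$⟩ʳ i)                       ≡⟨ sym (∑-permute _ (A (σ ⟨$⟩ʳ i)) (flip τ)) ⟩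
      ∑ (m + m + l) (λ j → A (σ ⟨$⟩ʳ i) (τ ⟨$⟩ˡ j)) ≡⟨ ∑-cong _ (λ j → sym (entry i j)) ⟩
      rowSum B i                                ≡⟨ sym (rowSum-≡ i) ⟩
      rowSum A i                                ∎
      where open ≡-Reasoning

    colSum-invariant : ∀ j → colSum A (τ ⟨$⟩ˡ j) ≡ colSum A j
    colSum-invariant j = begin
      colSum A (τ ⟨$⟩ˡ j)                       ≡⟨ sym (∑-permute _ (λ i → A i (τ ⟨$⟩ˡ j)) σ) ⟩
      ∑ (n + n + k) (λ i → A (σ ⟨$⟩ʳ i) (τ ⟨$⟩ˡ j)) ≡⟨ ∑-cong _ (λ i → sym (entry i j)) ⟩
      colSum B j                                ≡⟨ sym (colSum-≡ j) ⟩
      colSum A j                                ∎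
      where open ≡-Reasoning

    module Rows = R.Separation (σ ⟨$⟩ʳ_) (rowSum A) rowSum-invariant row-separated
    module Cols = C.Separation (τ ⟨$⟩ˡ_) (colSum A) colSum-invariant col-separated

    rowImage : Bool → Fin n → Bool
    rowImage u x = proj₁ (Rows.core↦core u x)

    colImage : Bool → Fin m → Bool
    colImage v y = proj₁ (Cols.core↦core v y)

    core-xor : ∀ u x v y → rowImage u x xor colImage v y ≡ not (u xor v)
    core-xor u x v y = sym (indicator-injective (begin
      indicator (not (u xor v))                      ≡⟨ sym (B-core u v x y) ⟩
      BB.block (core u) (core v) x y                 ≡⟨ sym (BB.Block3-ι (core u) (core v) x y) ⟩
      B (R.ι (core u) x) (C.ι (core v) y)            ≡⟨ entry _ _ ⟩
      A (σ ⟨$⟩ʳ R.ι (core u) x) (τ ⟨$⟩ˡ C.ι (core v) y) ≡⟨ cong₂ A (proj₂ (proj₂ σ-core)) (proj₂ (proj₂ τ-core)) ⟩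
      A (R.ι (core u′) x′) (C.ι (core v′) y′)        ≡⟨ BA.Block3-ι (core u′) (core v′) x′ y′ ⟩
      BA.block (core u′) (core v′) x′ y′             ≡⟨ A-core u′ v′ x′ y′ ⟩
      indicator (u′ xor v′)                          ∎))
      where
      open ≡-Reasoning
      σ-core = Rows.core↦core u x
      τ-core = Cols.core↦core v y
      u′ = proj₁ σ-core
      x′ = proj₁ (proj₂ σ-core)
      v′ = proj₁ τ-core
      y′ = proj₁ (proj₂ τ-core)

    -- c is true exactly when σ exchanges the two core row blocks.
    c : Bool
    c = rowImage false x₀

    col-shift : ∀ v y → colImage v y ≡ not c xor v
    col-shift v y = xor≡not⇒ c (core-xor false x₀ v y)

    colImage-reference : colImage false y₀ ≡ not c
    colImage-reference = trans (col-shift false y₀) (xor-identityʳ (not c))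

    row-shift : ∀ u x → rowImage u x ≡ c xor u
    row-shift u x = trans (xor≡not⇒ (not c) not-c-xor) (cong (_xor u) (not-involutive c))
      where
      not-c-xor : not c xor rowImage u x ≡ not u
      not-c-xor = begin
        not c xor rowImage u x               ≡⟨ cong (_xor rowImage u x) (sym colImage-reference) ⟩
        colImage false y₀ xor rowImage u x   ≡⟨ xor-comm (colImage false y₀) (rowImage u x) ⟩
        rowImage u x xor colImage false y₀   ≡⟨ core-xor u x false y₀ ⟩
        not (u xor false)                    ≡⟨ cong not (xor-identityʳ u) ⟩
        not u                                ∎
        where open ≡-Reasoning

    σ-sends : ∀ p → R.Sends (σ ⟨$⟩ʳ_) p (shift c p)
    σ-sends (core u) x = let _ , x′ , σ-core = Rows.core↦core u x in
      x′ , subst (λ w → σ ⟨$⟩ʳ R.ι (core u) x ≡ R.ι (core w) x′) (row-shift u x) σ-core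
    σ-sends rim = Rows.rim↦rim

    τ⁻¹-sends : ∀ q → C.Sends (τ ⟨$⟩ˡ_) q (shift (not c) q)
    τ⁻¹-sends (core v) y = let _ , y′ , τ-core = Cols.core↦core v y in
      y′ , subst (λ w → τ ⟨$⟩ˡ C.ι (core v) y ≡ C.ι (core w) y′) (col-shift v y) τ-core
    τ⁻¹-sends rim = Cols.rim↦rim

    blocksMatch : ∃[ c ] ∃[ φ ] ∃[ ψ ] BlocksMatch c φ ψ
    blocksMatch = let φ , ψ , iso = isomorphic⇒blockwiseIso {c} {not c} σ τ B≐σAτ σ-sends τ⁻¹-sends in
      c , φ , ψ , blockwiseIso⇒blocksMatch {c} {φ} {ψ} iso

  fixable⇒isomorphic : Fixable X₁ X₂ X₃ X₄ Y → Isomorphic A B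
  fixable⇒isomorphic fixable = let c , φ , ψ , match = fixable⇒blocksMatch fixable in
    blockwiseIso⇒isomorphic {c} {not c} {φ} {ψ} (blocksMatch⇒blockwiseIso {c} {φ} {ψ} match)

  -- The points of Fin n and Fin m (k₁, k₂ > 0) serve as a reference row and column.
  isomorphic⇒fixable : Fin n → Fin m →
    Binary X₁ → Binary X₂ → Binary X₃ → Binary X₄ → Binary Y → GramMates A B →
    (∀ x r → rowSum A (R.ι (core false) x) ≢ rowSum A (R.ι rim r)) →
    (∀ x r → rowSum A (R.ι (core true) x) ≢ rowSum A (R.ι rim r)) →
    (∀ y c → colSum A (C.ι (core false) y) ≢ colSum A (C.ι rim c)) →
    (∀ y c → colSum A (C.ι (core true) y) ≢ colSum A (C.ι rim c)) →
    Isomorphic A B → Fixable X₁ X₂ X₃ X₄ Y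
  isomorphic⇒fixable x₀ y₀ X₁-binary X₂-binary X₃-binary X₄-binary Y-binary gram row₁ row₂ col₁ col₂
                     (σ , τ , B≐σAτ) =
    let c , φ , ψ , match = FromIsomorphism.blocksMatch x₀ y₀ row-separated col-separated
                              (GramMates⇒rowSum-≡ A-bin B-bin gram) (GramMates⇒colSum-≡ A-bin B-bin gram) σ τ B≐σAτ
    in blocksMatch⇒fixable {c} {φ} {ψ} match
    where
    A-bin : Binary A
    A-bin = A-binary X₁-binary X₂-binary X₃-binary X₄-binary Y-binary
    B-bin : Binary B
    B-bin = B-binary X₁-binary X₂-binary X₃-binary X₄-binary Y-binary
    row-separated : ∀ u x r → rowSum A (R.ι (core u) x) ≢ rowSum A (R.ι rim r)
    row-separated false = row₁
    row-separated true  = row₂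
    col-separated : ∀ v y c → colSum A (C.ι (core v) y) ≢ colSum A (C.ι rim c)
    col-separated false = col₁
    col-separated true  = col₂

proposition6p5 : (k₁ k₂ s t : ℕ) → (X₁ X₂ : Mat (suc k₁) t) → (X₃ X₄ : Mat s (suc k₂)) → (Y : Mat s t) →
    Binary X₁ → Binary X₂ → Binary X₃ → Binary X₄ → Binary Y →
    GramMates (MatA X₁ X₂ X₃ X₄ Y) (MatB X₁ X₂ X₃ X₄ Y) →
    ((i : Fin (suc k₁)) (r : Fin s) → rowSum (MatA X₁ X₂ X₃ X₄ Y) (idx₁ {suc k₁} {suc k₁} {s} i) ≢ rowSum (MatA X₁ X₂ X₃ X₄ Y) (idx₃ {suc k₁} {suc k₁} {s} r)) →
    ((i : Fin (suc k₁)) (r : Fin s) → rowSum (MatA X₁ X₂ X₃ X₄ Y) (idx₂ {suc k₁} {suc k₁} {s} i) ≢ rowSum (MatA X₁ X₂ X₃ X₄ Y) (idx₃ {suc k₁} {suc k₁} {s} r)) →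
    ((j : Fin (suc k₂)) (c : Fin t) → colSum (MatA X₁ X₂ X₃ X₄ Y) (idx₁ {suc k₂} {suc k₂} {t} j) ≢ colSum (MatA X₁ X₂ X₃ X₄ Y) (idx₃ {suc k₂} {suc k₂} {t} c)) →
    ((j : Fin (suc k₂)) (c : Fin t) → colSum (MatA X₁ X₂ X₃ X₄ Y) (idx₂ {suc k₂} {suc k₂} {t} j) ≢ colSum (MatA X₁ X₂ X₃ X₄ Y) (idx₃ {suc k₂} {suc k₂} {t} c)) →
    (Isomorphic (MatA X₁ X₂ X₃ X₄ Y) (MatB X₁ X₂ X₃ X₄ Y) ⇔ Fixable X₁ X₂ X₃ X₄ Y)
proposition6p5 k₁ k₂ s t X₁ X₂ X₃ X₄ Y X₁-binary X₂-binary X₃-binary X₄-binary Y-binary gram row₁ row₂ col₁ col₂ =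
  mk⇔ (isomorphic⇒fixable zero zero X₁-binary X₂-binary X₃-binary X₄-binary Y-binary gram row₁ row₂ col₁ col₂)
      fixable⇒isomorphic
  where open MatAB X₁ X₂ X₃ X₄ Y
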